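{- Let $D$ be a binary dataset over attributes $A=\{a_1,\dots,a_K\}$ and let $\mathcal{F}$ be a downward closed family of itemsets over $A$ in which every itemset has at most 2 items. Then the algorithm SetPack (described in the context) applied to $\mathcal{F}$ returns an optimal tree model: its output $\mathcal{S}=(S_1,\dots,S_K)$, with trees $T_i=\mathrm{best}(a_i;S_i,\mathcal{F})$, is a decision tree model of minimum total cost $\sum_i \mathrm{cost}(T_i)$ among all decision tree models $\{T'_1,\dots,T'_K\}$ with $\mathrm{sets}(T'_i)\subseteq\mathcal{F}$ for all $i$.
   Context: A binary dataset $D$ is a finite multiset of transactions (binary vectors of length $K$); attribute $a_i$ is coordinate $i$; $q_D$ is the empirical distribution and $\mathrm{fr}(X)=q_D(X=1)$. Logarithms are base 2 and $0\log 0=0$. Decision trees: a tree $T$ encoding the target $\mathrm{target}(T)=a_t$ is a binary tree whose internal nodes test the value of an attribute other than $a_t$ (no attribute repeated on a root-to-leaf path); each transaction is routed to one leaf; $\mathrm{src}(T)$ is the set of attributes tested in $T$. For a leaf $L$, $\mathrm{pos}(L)$/$\mathrm{neg}(L)$ are the attributes tested positive/negative on its root path, $q_D(L)$ is the fraction of transactions routed to $L$, and $\mathrm{sets}(L)=\{V\cup\mathrm{pos}(L)\mid V\subseteq\mathrm{neg}(L)\}\cup\{V\cup\mathrm{pos}(L)\cup\{a_t\}\mid V\subseteq\mathrm{neg}(L)\}$; $\mathrm{sets}(T)=\bigcup_{L}\mathrm{sets}(L)$ over leaves of $T$. Cost: with $M$ the number of transactions routed to leaf $L$, $C(L)=\log\sum_{k=0}^{M}\binom{M}{k}(k/M)^k((M-k)/M)^{M-k}$;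 $\mathrm{cost}_D(T)=-|D|\sum_{L}\sum_{v\in\{0,1\}}q_D(a_t=v,L)\log q_D(a_t=v\mid L)$; and $\mathrm{cost}(T)=\sum_{N \text{ internal}}(1+\log K)+\mathrm{cost}_D(T)+\sum_{L\text{ leaf}}(1+C(L))$. A decision tree model is a set $\{T_1,\dots,T_K\}$ with $\mathrm{target}(T_i)=a_i$ such that the dependency graph on vertices $a_1,\dots,a_K$ with edges $(a_i,a_s)$ for $a_s\in\mathrm{src}(T_i)$ is acyclic. $\mathrm{best}(a_t;S,\mathcal{F})=\arg\min_T\{\mathrm{cost}(T)\mid \mathrm{target}(T)=a_t,\ \mathrm{src}(T)\subseteq S,\ \mathrm{sets}(T)\subseteq\mathcal{F}\}$. Algorithm SetPack: initialize $S_i=\emptyset$ and $r_i=\mathrm{false}$ for all $i$. While some $r_i=\mathrm{false}$: build a weighted directed graph $H$ on vertices $v_0,v_1,\dots,v_K$; for each $i$ add the edge $(v_i,v_0)$ with weight $w(v_i,v_0)=\mathrm{cost}(\mathrm{best}(a_i;S_i,\mathcal{F}))$; if $r_i=\mathrm{false}$, then for each $j$ let $T=\mathrm{best}(a_i;S_i\cup\{a_j\},\mathcal{F})$ and, if $\mathrm{cost}(T)\le w(v_i,v_0)$, add edge $(v_i,v_j)$ with weight $\mathrm{cost}(T)$. Compute a minimum-weight directed spanning tree $U$ of $H$ with sink $v_0$ (every vertex other than $v_0$ has exactly one outgoing edge). For each $i$ with $(v_i,v_0)\in E(U)$ and $r_i=\mathrm{false}$: set $r_i=\mathrm{true}$ and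 add $a_i$ to $S_j$ for every $v_j$ that is an ancestor of $v_i$ in $U$ (i.e. has a directed path to $v_i$ in $U$). Return $\mathcal{S}=(S_1,\dots,S_K)$. -}

module Defs where

open import Data.Nat using (ℕ; zero; suc; _+_; _*_; _∸_; _^_; _≤_)
open import Data.Nat.Combinatorics using (_C_)
open import Data.Bool using (Bool; true; false; _∨_; not)
open import Data.Fin using (Fin)
open import Data.Fin.Subset using (Subset; _∈_; _∉_; _⊆_; _∪_; ⁅_⁆; ∣_∣) renaming (⊥ to ∅)
open import Data.List using (List; []; _∷_; _++_; map; length; upTo; foldr; allFin)
open import Data.Nat.ListAction using (sum)
open import Data.List.Relation.Unary.All using (All)
open import Data.Maybe using (Maybe; just; nothing; is-nothing)
open import Data.Product using (Σ; ∃; _×_; _,_; proj₁; proj₂)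
open import Data.Sum using (_⊎_)
open import Data.Integer using (+_)
open import Data.Rational.Unnormalised using (ℚᵘ; mkℚᵘ; 0ℚᵘ; 1ℚᵘ) renaming (_*_ to _*q_; _≤_ to _≤q_)
open import Relation.Binary.PropositionalEquality using (_≡_; _≢_)
open import Relation.Nullary using (¬_)
open import Relation.Binary.Construct.Closure.Transitive using (TransClosure)

-- A transaction over attributes a_1..a_K (attribute a_i = coordinate i : Fin K).
Transaction : ℕ → Set
Transaction K = Fin K → Bool

-- A binary dataset: finite multiset of transactions, represented as a list.
Dataset : ℕ → Set
Dataset K = List (Transaction K)

Family : ℕ → Set₁
Family K = Subset K → Set

DownwardClosed : ∀ {K} → Family K → Set
DownwardClosed F = ∀ X Y → X ⊆ Y → F Y → F X

-- node a t₀ t₁ tests attribute a: transactions with a = 0 go to t₀,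
-- transactions with a = 1 go to t₁.
data Tree (K : ℕ) : Set where
  leaf : Tree K
  node : Fin K → Tree K → Tree K → Tree K

-- Validity for target a_t: no tested attribute equals a_t, and no attribute
-- is repeated on a root-to-leaf path (`used` = attributes tested above).
ValidFrom : ∀ {K} → Fin K → Subset K → Tree K → Set
ValidFrom t used leaf = Data.Unit.⊤ where import Data.Unit
ValidFrom t used (node a l r) =
  (a ≢ t) × (a ∉ used) × ValidFrom t (used ∪ ⁅ a ⁆) l × ValidFrom t (used ∪ ⁅ a ⁆) r

Valid : ∀ {K} → Fin K → Tree K → Set
Valid t T = ValidFrom t ∅ T

src : ∀ {K} → Tree K → Subset K
src leaf = ∅
src (node a l r) = ⁅ a ⁆ ∪ (src l ∪ src r)

-- Leaves with pos(L), neg(L), and the transactions of D routed to L.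
record LeafInfo (K : ℕ) : Set where
  constructor leafInfo
  field
    pos  : Subset K
    neg  : Subset K
    rows : Dataset K

open LeafInfo public

select : ∀ {K} → Fin K → Bool → Dataset K → Dataset K
select a b [] = []
select a true  (x ∷ xs) with x a
... | true  = x ∷ select a true xs
... | false = select a true xs
select a false (x ∷ xs) with x a
... | true  = select a false xs
... | false = x ∷ select a false xs

addPos : ∀ {K} → Fin K → LeafInfo K → LeafInfo K
addPos a (leafInfo p n d) = leafInfo (⁅ a ⁆ ∪ p) n d

addNeg : ∀ {K} → Fin K → LeafInfo K → LeafInfo K
addNeg a (leafInfo p n d) = leafInfo p (⁅ a ⁆ ∪ n) d

-- Every leaf of T (also leaves receiving no transaction), with its routed data.
leafData : ∀ {K} → Tree K → Dataset K → List (LeafInfo K)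
leafData leaf D = leafInfo ∅ ∅ D ∷ []
leafData (node a l r) D =
  map (addNeg a) (leafData l (select a false D)) ++
  map (addPos a) (leafData r (select a true D))

internals : ∀ {K} → Tree K → ℕ
internals leaf = 0
internals (node a l r) = suc (internals l + internals r)

-- sets(T) ⊆ F, unfolded: for every leaf L and every V ⊆ neg(L),
-- V ∪ pos(L) ∈ F and V ∪ pos(L) ∪ {a_t} ∈ F.
SetsLeaf : ∀ {K} → Family K → Fin K → LeafInfo K → Set
SetsLeaf F t L = ∀ V → V ⊆ neg L → F (V ∪ pos L) × F ((V ∪ pos L) ∪ ⁅ t ⁆)

SetsIn : ∀ {K} → Dataset K → Family K → Fin K → Tree K → Set
SetsIn D F t T = All (SetsLeaf F t) (leafData T D)

-- Costs are real numbers of the form  n + log q  (q rational);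
-- we represent a cost c exactly by the positive rational 2^c ("exponentiated
-- cost").  Sums of costs become products, and c ≤ c' iff 2^c ≤ 2^c'.

-- n ÷ d as an (unnormalised) rational; only used with d ≥ 1.
_÷_ : ℕ → ℕ → ℚᵘ
n ÷ zero  = 0ℚᵘ
n ÷ suc d = mkℚᵘ (+ n) d

prodQ : List ℚᵘ → ℚᵘ
prodQ = foldr _*q_ 1ℚᵘ

count : ∀ {K} → Fin K → Bool → Dataset K → ℕ
count a b D = length (select a b D)

-- 2^{C(L)} = Σ_{k=0}^{M} (M choose k) k^k (M-k)^{M-k} / M^M   (with 0^0 = 1)
expC : ℕ → ℚᵘ
expC M = sum (map (λ k → (M C k) * (k ^ k) * ((M ∸ k) ^ (M ∸ k))) (upTo (suc M))) ÷ (M ^ M)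

-- 2^{1 + C(L)} times the contribution 2^{...} of L to cost_D(T):
-- -Σ_v n_v log(n_v / M) gives  M^M / (n_0^{n_0} n_1^{n_1}).
leafFactor : ∀ {K} → Fin K → LeafInfo K → ℚᵘ
leafFactor t L =
  let M  = length (rows L)
      n₀ = count t false (rows L)
      n₁ = count t true  (rows L)
  in ((2 ÷ 1) *q expC M) *q ((M ^ M) ÷ ((n₀ ^ n₀) * (n₁ ^ n₁)))

-- expCost D t T = 2^{cost(T)} for a tree T with target a_t over K attributes:
-- each internal node contributes 2^{1 + log K} = 2K.
expCost : ∀ {K} → Dataset K → Fin K → Tree K → ℚᵘ
expCost {K} D t T = (((2 * K) ^ internals T) ÷ 1) *q prodQ (map (leafFactor t) (leafData T D))

IsBest : ∀ {K} → Dataset K → Family K → Fin K → Subset K → Tree K → Set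
IsBest D F t S T =
  Valid t T × src T ⊆ S × SetsIn D F t T ×
  (∀ T' → Valid t T' → src T' ⊆ S → SetsIn D F t T' → expCost D t T ≤q expCost D t T')

totalExpCost : ∀ {K} → Dataset K → (Fin K → Tree K) → ℚᵘ
totalExpCost {K} D Ts = prodQ (map (λ i → expCost D i (Ts i)) (allFin K))

DepEdge : ∀ {K} → (Fin K → Tree K) → Fin K → Fin K → Set
DepEdge Ts i s = s ∈ src (Ts i)

IsModel : ∀ {K} → (Fin K → Tree K) → Set
IsModel {K} Ts = (∀ i → Valid i (Ts i)) × (∀ i → ¬ TransClosure (DepEdge Ts) i i)

-- SetPack, as a (nondeterministic) transition relation on states (S, r).
-- Nondeterminism: choice among tied minimisers in best(...) and among
-- minimum-weight spanning trees.

State : ℕ → Set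
State K = (Fin K → Subset K) × (Fin K → Bool)

initState : ∀ {K} → State K
initState = (λ _ → ∅) , (λ _ → false)

-- A spanning tree U of H with sink v₀: U i = nothing means the outgoing edge
-- of v_i is (v_i, v₀), U i = just j means it is (v_i, v_j).
ParEdge : ∀ {K} → (Fin K → Maybe (Fin K)) → Fin K → Fin K → Set
ParEdge U i j = U i ≡ just j

IsArborescence : ∀ {K} → (Fin K → Maybe (Fin K)) → Set
IsArborescence U = ∀ i → ¬ TransClosure (ParEdge U) i i

module _ {K : ℕ} (D : Dataset K) (S : Fin K → Subset K) (r : Fin K → Bool)
         (B : Fin K → Tree K) (B' : Fin K → Fin K → Tree K) where

  -- U uses only edges of H: (v_i, v_j) is in H iff r_i = false and
  -- cost(best(a_i; S_i ∪ {a_j})) ≤ w(v_i, v₀) = cost(best(a_i; S_i)).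
  InH : (Fin K → Maybe (Fin K)) → Set
  InH U = ∀ i j → U i ≡ just j → (r i ≡ false) × (expCost D i (B' i j) ≤q expCost D i (B i))

  edgeWeight : (Fin K → Maybe (Fin K)) → Fin K → ℚᵘ
  edgeWeight U i with U i
  ... | nothing = expCost D i (B i)
  ... | just j  = expCost D i (B' i j)

  expWeight : (Fin K → Maybe (Fin K)) → ℚᵘ
  expWeight U = prodQ (map (edgeWeight U) (allFin K))

record Step {K : ℕ} (D : Dataset K) (F : Family K) (st st' : State K) : Set where
  S  = proj₁ st
  r  = proj₂ st
  S' = proj₁ st'
  r' = proj₂ st'
  field
    someFalse : ∃ λ i → r i ≡ false
    B       : Fin K → Tree K
    B-best  : ∀ i → IsBest D F i (S i) (B i)
    B'      : Fin K → Fin K → Tree K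
    B'-best : ∀ i j → r i ≡ false → IsBest D F i (S i ∪ ⁅ j ⁆) (B' i j)
    U       : Fin K → Maybe (Fin K)
    U-inH   : InH D S r B B' U
    U-arb   : IsArborescence U
    U-min   : ∀ U' → InH D S r B B' U' → IsArborescence U' →
              expWeight D S r B B' U ≤q expWeight D S r B B' U'
    r-upd   : ∀ i → r' i ≡ (r i ∨ is-nothing (U i))
    S-upd   : ∀ j x →
              ((x ∈ S' j) → (x ∈ S j ⊎ ((U x ≡ nothing) × (r x ≡ false) × TransClosure (ParEdge U) j x))) ×
              ((x ∈ S j ⊎ ((U x ≡ nothing) × (r x ≡ false) × TransClosure (ParEdge U) j x)) → (x ∈ S' j))

{-# OPTIONS --safe #-}
module Submission where

-- A minimum spanning arborescence U of one round's graph H is also a spanning arborescence of the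
-- next round's graph: its non-sink edges leave unfinished vertices, which stay unfinished, and its
-- weight can only drop, because best(a_i; S, F) gets cheaper as S grows. Hence the minimum
-- arborescence weight never increases along the run, and in the last graph, where every vertex is
-- finished, the only arborescence is the returned model itself. In the first round S_i = ∅, and an
-- itemset bound of 2 forces every admissible tree to test at most one attribute a_j (a leaf below two
-- tests would put three items into sets(T)); so any tree model, read as the edges (v_i, v_j) or
-- (v_i, v₀), is a spanning arborescence of the first graph of weight at most its cost.

open import Defs
open import Data.Nat using (ℕ; zero; suc; _≤_; _<_; _^_; _*_; s≤s; z≤n)
open import Data.Nat.Properties using (≤-trans; <-trans; <-irrefl; ≤⇒≯; m<n⇒m<1+n; n<1+n)
open import Data.Bool using (Bool; true; false; _∨_; if_then_else_)
open import Data.Fin using (Fin)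
open import Data.Fin.Subset using (Subset; ∣_∣; _∈_; _∉_; _⊆_; _∪_; ⁅_⁆) renaming (⊥ to ∅)
open import Data.Fin.Subset.Properties
  using (p⊆p∪q; q⊆p∪q; x∈p∪q⁻; x∈p∪q⁺; x∈⁅x⁆; ⊆-refl; ⊆-trans; ⊆-reflexive; ∪-identityʳ; ∉⊥;
         x∈p⇒∣p-x∣<∣p∣; x∈p∧x≢y⇒x∈p-y)
open import Data.Product using (Σ; _×_; _,_; proj₁; proj₂)
open import Data.Sum using (inj₁; inj₂; map₁; map₂)
open import Data.Maybe using (Maybe; just; nothing; is-nothing)
open import Data.List using ([]; _∷_; map; length; allFin)
open import Data.List.Relation.Unary.All using (All; _∷_)
open import Data.List.Relation.Unary.All.Properties using (map⁻; ++⁻ˡ; ++⁻ʳ)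
open import Data.Empty using (⊥; ⊥-elim)
open import Data.Rational.Unnormalised using (ℚᵘ; NonNegative) renaming (_≤_ to _≤q_; _*_ to _*q_)
open import Data.Rational.Unnormalised.Properties
  using (nonNeg*nonNeg⇒nonNeg; *-mono-≤-nonNeg; module ≤-Reasoning)
  renaming (≤-refl to ≤q-refl; ≤-trans to ≤q-trans)
open import Relation.Binary.PropositionalEquality using (_≡_; _≢_; refl; sym; trans; cong; cong₂)
open import Relation.Binary.Construct.Closure.ReflexiveTransitive using (Star; ε; _◅_)
open import Relation.Binary.Construct.Closure.Transitive using (TransClosure; [_]; _∷_)
open import Relation.Nullary using (¬_)

÷-nonNeg : ∀ n d → NonNegative (n ÷ d)
÷-nonNeg n zero    = _
÷-nonNeg n (suc d) = _

*-nonNeg : ∀ p q → NonNegative p → NonNegative q → NonNegative (p *q q)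
*-nonNeg p q p≥0 q≥0 = nonNeg*nonNeg⇒nonNeg p {{p≥0}} q {{q≥0}}

prodQ-map-nonNeg : ∀ {A : Set} {f : A → ℚᵘ} → (∀ x → NonNegative (f x)) →
                   ∀ xs → NonNegative (prodQ (map f xs))
prodQ-map-nonNeg f≥0 []                 = _
prodQ-map-nonNeg {f = f} f≥0 (x ∷ xs) =
  *-nonNeg (f x) (prodQ (map f xs)) (f≥0 x) (prodQ-map-nonNeg f≥0 xs)

prodQ-map-mono : ∀ {A : Set} {f g : A → ℚᵘ} → (∀ x → NonNegative (f x)) → (∀ x → f x ≤q g x) →
                 ∀ xs → prodQ (map f xs) ≤q prodQ (map g xs)
prodQ-map-mono f≥0 f≤g []       = ≤q-refl
prodQ-map-mono f≥0 f≤g (x ∷ xs) =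
  *-mono-≤-nonNeg {{f≥0 x}} {{prodQ-map-nonNeg f≥0 xs}} (f≤g x) (prodQ-map-mono f≥0 f≤g xs)

leafFactor-nonNeg : ∀ {K} (t : Fin K) L → NonNegative (leafFactor t L)
leafFactor-nonNeg t L =
  *-nonNeg ((2 ÷ 1) *q expC M) ((M ^ M) ÷ ((n₀ ^ n₀) * (n₁ ^ n₁)))
    (*-nonNeg (2 ÷ 1) (expC M) _ (÷-nonNeg _ (M ^ M)))
    (÷-nonNeg (M ^ M) ((n₀ ^ n₀) * (n₁ ^ n₁)))
  where
    M  = length (rows L)
    n₀ = count t false (rows L)
    n₁ = count t true  (rows L)

expCost-nonNeg : ∀ {K} (D : Dataset K) t T → NonNegative (expCost D t T)
expCost-nonNeg {K} D t T =
  *-nonNeg (((2 * K) ^ internals T) ÷ 1) (prodQ (map (leafFactor t) (leafData T D)))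
    (÷-nonNeg _ 1) (prodQ-map-nonNeg (leafFactor-nonNeg t) (leafData T D))

true≢false : true ≢ false
true≢false ()

∪-monoˡ-⊆ : ∀ {n} {p q : Subset n} r → p ⊆ q → p ∪ r ⊆ q ∪ r
∪-monoˡ-⊆ {p = p} r p⊆q x∈p∪r = x∈p∪q⁺ (map₁ p⊆q (x∈p∪q⁻ p r x∈p∪r))

distinct³⇒3≤∣p∣ : ∀ {n} {p : Subset n} {x y z} → x ∈ p → y ∈ p → z ∈ p →
                  x ≢ y → x ≢ z → y ≢ z → 3 ≤ ∣ p ∣
distinct³⇒3≤∣p∣ x∈p y∈p z∈p x≢y x≢z y≢z =
  ≤-trans (s≤s (≤-trans (s≤s (≤-trans (s≤s z≤n) (x∈p⇒∣p-x∣<∣p∣ z∈p-x-y)))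
                        (x∈p⇒∣p-x∣<∣p∣ y∈p-x)))
          (x∈p⇒∣p-x∣<∣p∣ x∈p)
  where
    y∈p-x = x∈p∧x≢y⇒x∈p-y y∈p (λ y≡x → x≢y (sym y≡x))
    z∈p-x-y = x∈p∧x≢y⇒x∈p-y (x∈p∧x≢y⇒x∈p-y z∈p (λ z≡x → x≢z (sym z≡x))) (λ z≡y → y≢z (sym z≡y))

⁺-map : ∀ {A : Set} {R Q : A → A → Set} → (∀ {x y} → R x y → Q x y) →
        ∀ {x y} → TransClosure R x y → TransClosure Q x y
⁺-map R⇒Q [ xRy ]        = [ R⇒Q xRy ]
⁺-map R⇒Q (xRy ∷ yR⁺z) = R⇒Q xRy ∷ ⁺-map R⇒Q yR⁺z

⁺-descending : ∀ {A : Set} {R : A → A → Set} (f : A → ℕ) → (∀ {x y} → R x y → f y < f x) →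
               ∀ {x y} → TransClosure R x y → f y < f x
⁺-descending f desc [ xRy ]        = desc xRy
⁺-descending f desc (xRy ∷ yR⁺z) = <-trans (⁺-descending f desc yR⁺z) (desc xRy)

descending⇒acyclic : ∀ {A : Set} {R : A → A → Set} (f : A → ℕ) → (∀ {x y} → R x y → f y < f x) →
                     ∀ x → ¬ TransClosure R x x
descending⇒acyclic f desc x xR⁺x = <-irrefl refl (⁺-descending f desc xR⁺x)

module SetPack {K : ℕ} (D : Dataset K) (F : Family K) where

  best-optimal : ∀ {t S T} → IsBest D F t S T →
                 ∀ T' → Valid t T' → src T' ⊆ S → SetsIn D F t T' → expCost D t T ≤q expCost D t T'
  best-optimal (_ , _ , _ , optimal) = optimal

  best-antitone : ∀ {t S S' T T'} → IsBest D F t S T → IsBest D F t S' T' → S ⊆ S' →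
                  expCost D t T' ≤q expCost D t T
  best-antitone (T-valid , T-src , T-sets , _) T'-best S⊆S' =
    best-optimal T'-best _ T-valid (⊆-trans T-src S⊆S') T-sets

  record Bests (st : State K) : Set where
    field
      B       : Fin K → Tree K
      B-best  : ∀ i → IsBest D F i (proj₁ st i) (B i)
      B'      : Fin K → Fin K → Tree K
      B'-best : ∀ i j → proj₂ st i ≡ false → IsBest D F i (proj₁ st i ∪ ⁅ j ⁆) (B' i j)

  open Bests

  weight : ∀ {st} → Bests st → (Fin K → Maybe (Fin K)) → ℚᵘ
  weight {st} b = expWeight D (proj₁ st) (proj₂ st) (B b) (B' b)

  FromUnfinished : (Fin K → Bool) → (Fin K → Maybe (Fin K)) → Set
  FromUnfinished r U = ∀ i j → U i ≡ just j → r i ≡ false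

  step-unfinished : ∀ {st st'} (s : Step D F st st') → FromUnfinished (proj₂ st) (Step.U s)
  step-unfinished s i j Ui≡j = proj₁ (Step.U-inH s i j Ui≡j)

  step-stays-unfinished : ∀ {st st'} (s : Step D F st st') → FromUnfinished (proj₂ st') (Step.U s)
  step-stays-unfinished s i j Ui≡j =
    trans (Step.r-upd s i) (cong₂ _∨_ (step-unfinished s i j Ui≡j) (cong is-nothing Ui≡j))

  step-⊆ : ∀ {st st'} → Step D F st st' → ∀ i → proj₁ st i ⊆ proj₁ st' i
  step-⊆ s i {x} x∈S = proj₂ (Step.S-upd s i x) (inj₁ x∈S)

  -- Since best costs only drop when a source is allowed, H has every edge out of an unfinished vertex.
  InH-bests : ∀ {st U} (b : Bests st) → FromUnfinished (proj₂ st) U →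
              InH D (proj₁ st) (proj₂ st) (B b) (B' b) U
  InH-bests b unf i j Ui≡j =
    unf i j Ui≡j , best-antitone (B-best b i) (B'-best b i j (unf i j Ui≡j)) (p⊆p∪q ⁅ j ⁆)

  edgeWeight-nonNeg : ∀ {st} (b : Bests st) U i →
                      NonNegative (edgeWeight D (proj₁ st) (proj₂ st) (B b) (B' b) U i)
  edgeWeight-nonNeg b U i with U i
  ... | nothing = expCost-nonNeg D i (B b i)
  ... | just j  = expCost-nonNeg D i (B' b i j)

  expWeight-antitone : ∀ {st₁ st₂ U} (b₁ : Bests st₁) (b₂ : Bests st₂) →
                       (∀ i → proj₁ st₂ i ⊆ proj₁ st₁ i) →
                       FromUnfinished (proj₂ st₁) U → FromUnfinished (proj₂ st₂) U →
                       weight b₁ U ≤q weight b₂ U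
  expWeight-antitone {st₁} {st₂} {U} b₁ b₂ S₂⊆S₁ unf₁ unf₂ =
    prodQ-map-mono (edgeWeight-nonNeg b₁ U) edgeWeight-antitone (allFin K)
    where
      edgeWeight₁ edgeWeight₂ : Fin K → ℚᵘ
      edgeWeight₁ = edgeWeight D (proj₁ st₁) (proj₂ st₁) (B b₁) (B' b₁) U
      edgeWeight₂ = edgeWeight D (proj₁ st₂) (proj₂ st₂) (B b₂) (B' b₂) U

      edgeWeight-antitone : ∀ i → edgeWeight₁ i ≤q edgeWeight₂ i
      edgeWeight-antitone i with U i in Ui≡
      ... | nothing = best-antitone (B-best b₂ i) (B-best b₁ i) (S₂⊆S₁ i)
      ... | just j  = best-antitone (B'-best b₂ i j (unf₂ i j Ui≡)) (B'-best b₁ i j (unf₁ i j Ui≡))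
                                    (∪-monoˡ-⊆ ⁅ j ⁆ (S₂⊆S₁ i))

  LowerBound : ℚᵘ → State K → Set
  LowerBound c st =
    ∀ (b : Bests st) U → FromUnfinished (proj₂ st) U → IsArborescence U → c ≤q weight b U

  step-bests : ∀ {st st'} → Step D F st st' → Bests st
  step-bests s = record
    { B = Step.B s ; B-best = Step.B-best s ; B' = Step.B' s ; B'-best = Step.B'-best s }

  lowerBound-step : ∀ {c st st'} → Step D F st st' → Bests st' → LowerBound c st' → LowerBound c st
  lowerBound-step {c} s b' bound b U₀ unf₀ arb₀ = begin
    c                        ≤⟨ bound b' U (step-stays-unfinished s) (Step.U-arb s) ⟩
    weight b' U              ≤⟨ expWeight-antitone b' (step-bests s) (step-⊆ s)
                                  (step-stays-unfinished s) (step-unfinished s) ⟩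
    weight (step-bests s) U  ≤⟨ Step.U-min s U₀ (InH-bests (step-bests s) unf₀) arb₀ ⟩
    weight (step-bests s) U₀ ≤⟨ expWeight-antitone (step-bests s) b (λ _ → ⊆-refl) unf₀ unf₀ ⟩
    weight b U₀              ∎
    where
      open ≤-Reasoning
      U = Step.U s

  finished-bests : ∀ {S r Ts} → (∀ i → r i ≡ true) → (∀ i → IsBest D F i (S i) (Ts i)) → Bests (S , r)
  finished-bests {Ts = Ts} finished Ts-best = record
    { B = Ts ; B-best = Ts-best ; B' = λ _ _ → leaf
    ; B'-best = λ i _ rᵢ≡false → ⊥-elim (true≢false (trans (sym (finished i)) rᵢ≡false)) }

  lowerBound-finished : ∀ {S r Ts} → (∀ i → r i ≡ true) → (∀ i → IsBest D F i (S i) (Ts i)) →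
                        LowerBound (totalExpCost D Ts) (S , r)
  lowerBound-finished {S} {r} {Ts} finished Ts-best b U unf _ =
    prodQ-map-mono (λ i → expCost-nonNeg D i (Ts i)) cost≤weight (allFin K)
    where
      cost≤weight : ∀ i → expCost D i (Ts i) ≤q edgeWeight D S r (B b) (B' b) U i
      cost≤weight i with U i in Ui≡
      ... | nothing = best-antitone (B-best b i) (Ts-best i) ⊆-refl
      ... | just j  = ⊥-elim (true≢false (trans (sym (finished i)) (unf i j Ui≡)))

  bests-run : ∀ {st st'} → Star (Step D F) st st' → Bests st' → Bests st
  bests-run ε       b' = b'
  bests-run (s ◅ _) _  = step-bests s

  lowerBound-run : ∀ {c st st'} → Star (Step D F) st st' → Bests st' → LowerBound c st' → LowerBound c st
  lowerBound-run ε            _  bound = bound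
  lowerBound-run (s ◅ steps) b' bound =
    lowerBound-step s (bests-run steps b') (lowerBound-run steps b' bound)

  record Ranking (st : State K) : Set where
    field
      rounds          : ℕ
      rank            : Fin K → ℕ
      rank<rounds     : ∀ x → proj₂ st x ≡ true → rank x < rounds
      source-finished : ∀ {j x} → x ∈ proj₁ st j → proj₂ st x ≡ true
      source-rank<    : ∀ {j x} → x ∈ proj₁ st j → proj₂ st j ≡ true → rank x < rank j

  ranking-init : Ranking initState
  ranking-init = record
    { rounds = 0 ; rank = λ _ → 0 ; rank<rounds = λ _ ()
    ; source-finished = λ x∈∅ → ⊥-elim (∉⊥ x∈∅) ; source-rank< = λ x∈∅ _ → ⊥-elim (∉⊥ x∈∅) }

  -- An attribute is ranked by the round in which it is finished: a_x enters S_j only in that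
  -- round and only for ancestors v_j of v_x, which are still unfinished afterwards.
  ranking-step : ∀ {st st'} → Step D F st st' → Ranking st → Ranking st'
  ranking-step {S , r} {S' , r'} s ρ = record
    { rounds = suc rounds ; rank = rank′ ; rank<rounds = rank′<rounds
    ; source-finished = λ x∈S'j → proj₁ (source′ x∈S'j)
    ; source-rank<    = λ x∈S'j → proj₂ (source′ x∈S'j) }
    where
      open Ranking ρ

      rank′ : Fin K → ℕ
      rank′ x = if r x then rank x else rounds

      rank′<rounds : ∀ x → r' x ≡ true → rank′ x < suc rounds
      rank′<rounds x _ with r x in rx≡
      ... | true  = m<n⇒m<1+n (rank<rounds x rx≡)
      ... | false = n<1+n rounds

      ancestor-unfinished : ∀ {j x} → TransClosure (ParEdge (Step.U s)) j x → r' j ≡ false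
      ancestor-unfinished [ Uj≡x ]     = step-stays-unfinished s _ _ Uj≡x
      ancestor-unfinished (Uj≡y ∷ _) = step-stays-unfinished s _ _ Uj≡y

      source′ : ∀ {j x} → x ∈ S' j → r' x ≡ true × (r' j ≡ true → rank′ x < rank′ j)
      source′ {j} {x} x∈S'j with proj₁ (Step.S-upd s j x) x∈S'j
      ... | inj₂ (Ux≡nothing , rx≡false , j⁺x) =
        trans (Step.r-upd s x) (cong₂ _∨_ rx≡false (cong is-nothing Ux≡nothing)) ,
        λ r'j≡true → ⊥-elim (true≢false (trans (sym r'j≡true) (ancestor-unfinished j⁺x)))
      ... | inj₁ x∈Sj with r x in rx≡ | source-finished x∈Sj
      ...   | false | ()
      ...   | true  | _ = trans (Step.r-upd s x) (cong (_∨ _) rx≡) , rank′x<rank′j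
        where
          rank′x<rank′j : r' j ≡ true → rank x < rank′ j
          rank′x<rank′j _ with r j in rj≡
          ... | true  = source-rank< x∈Sj rj≡
          ... | false = rank<rounds x rx≡

  ranking-run : ∀ {st st'} → Star (Step D F) st st' → Ranking st → Ranking st'
  ranking-run ε            ρ = ρ
  ranking-run (s ◅ steps) ρ = ranking-run steps (ranking-step s ρ)

  finished-acyclic : ∀ {S r Ts} → Ranking (S , r) → (∀ i → r i ≡ true) →
                     (∀ i → src (Ts i) ⊆ S i) → ∀ i → ¬ TransClosure (DepEdge Ts) i i
  finished-acyclic ρ finished src⊆S =
    descending⇒acyclic rank (λ {i} k∈src → source-rank< (src⊆S i k∈src) (finished i))
    where open Ranking ρ

tested : ∀ {K} → LeafInfo K → Subset K
tested L = neg L ∪ pos L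

∈-tested-addNeg : ∀ {K} a (L : LeafInfo K) → a ∈ tested (addNeg a L)
∈-tested-addNeg a L = p⊆p∪q (pos L) (p⊆p∪q (neg L) (x∈⁅x⁆ a))

∈-tested-addPos : ∀ {K} a (L : LeafInfo K) → a ∈ tested (addPos a L)
∈-tested-addPos a L = q⊆p∪q (neg L) _ (p⊆p∪q (pos L) (x∈⁅x⁆ a))

tested-addNeg : ∀ {K} a (L : LeafInfo K) → tested L ⊆ tested (addNeg a L)
tested-addNeg a L = ∪-monoˡ-⊆ (pos L) (q⊆p∪q ⁅ a ⁆ (neg L))

tested-addPos : ∀ {K} a (L : LeafInfo K) → tested L ⊆ tested (addPos a L)
tested-addPos a L x∈ = x∈p∪q⁺ (map₂ (q⊆p∪q ⁅ a ⁆ (pos L)) (x∈p∪q⁻ (neg L) (pos L) x∈))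

All-leafData-neg : ∀ {K} {P : LeafInfo K → Set} a l r D → All P (leafData (node a l r) D) →
                   All (λ L → P (addNeg a L)) (leafData l (select a false D))
All-leafData-neg a l r D all = map⁻ (++⁻ˡ (map (addNeg a) (leafData l (select a false D))) all)

All-leafData-pos : ∀ {K} {P : LeafInfo K → Set} a l r D → All P (leafData (node a l r) D) →
                   All (λ L → P (addPos a L)) (leafData r (select a true D))
All-leafData-pos a l r D all = map⁻ (++⁻ʳ (map (addNeg a) (leafData l (select a false D))) all)

All-leafData⇒∃ : ∀ {K} {P : LeafInfo K → Set} T D → All P (leafData T D) → Σ (LeafInfo K) P
All-leafData⇒∃ leaf         D (pL ∷ _) = _ , pL
All-leafData⇒∃ (node a l r) D all
  with L , pL ← All-leafData⇒∃ l (select a false D) (All-leafData-neg a l r D all)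
  = addNeg a L , pL

root : ∀ {K} → Tree K → Maybe (Fin K)
root leaf         = nothing
root (node a _ _) = just a

root-∈-src : ∀ {K} (T : Tree K) {a} → root T ≡ just a → a ∈ src T
root-∈-src (node a _ _) refl = p⊆p∪q _ (x∈⁅x⁆ a)

model-arborescence : ∀ {K} {Ts : Fin K → Tree K} → IsModel Ts → IsArborescence (λ i → root (Ts i))
model-arborescence {Ts = Ts} (_ , acyclic) i cycle =
  acyclic i (⁺-map (λ {j} → root-∈-src (Ts j)) cycle)

module Stumps {K : ℕ} {D : Dataset K} {F : Family K} (small : ∀ X → F X → ∣ X ∣ ≤ 2) where

  -- With V = neg(L), sets(L) contains tested(L) ∪ {a_t}, which would have three elements.
  two-tests-absurd : ∀ {t a b L} → a ≢ t → b ≢ t → a ≢ b → a ∈ tested L → b ∈ tested L →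
                     SetsLeaf F t L → ⊥
  two-tests-absurd {t} {L = L} a≢t b≢t a≢b a∈L b∈L setsL =
    ≤⇒≯ (small _ F[L∪t])
        (distinct³⇒3≤∣p∣ (p⊆p∪q ⁅ t ⁆ a∈L) (p⊆p∪q ⁅ t ⁆ b∈L) (q⊆p∪q (tested L) _ (x∈⁅x⁆ t)) a≢b a≢t b≢t)
    where
      F[L∪t] = proj₂ (setsL (neg L) ⊆-refl)

  ∉⁅⁆⇒≢ : ∀ {a b : Fin K} → b ∉ ∅ ∪ ⁅ a ⁆ → a ≢ b
  ∉⁅⁆⇒≢ {a} b∉ refl = b∉ (q⊆p∪q ∅ ⁅ a ⁆ (x∈⁅x⁆ a))

  no-nested-neg : ∀ {t a b l r r'} → Valid t (node a (node b l r) r') →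
                  SetsIn D F t (node a (node b l r) r') → ⊥
  no-nested-neg {a = a} {b} {l} {r} {r'} (a≢t , _ , (b≢t , b∉a , _) , _) sets
    with L , setsL ← All-leafData⇒∃ l (select b false (select a false D))
           (All-leafData-neg b l r (select a false D) (All-leafData-neg a (node b l r) r' D sets)) =
    two-tests-absurd {L = addNeg a (addNeg b L)} a≢t b≢t (∉⁅⁆⇒≢ b∉a)
      (∈-tested-addNeg a (addNeg b L)) (tested-addNeg a (addNeg b L) (∈-tested-addNeg b L)) setsL

  no-nested-pos : ∀ {t a b l r l'} → Valid t (node a l' (node b l r)) →
                  SetsIn D F t (node a l' (node b l r)) → ⊥
  no-nested-pos {a = a} {b} {l} {r} {l'} (a≢t , _ , _ , (b≢t , b∉a , _)) sets
    with L , setsL ← All-leafData⇒∃ l (select b false (select a true D))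
           (All-leafData-neg b l r (select a true D) (All-leafData-pos a l' (node b l r) D sets)) =
    two-tests-absurd {L = addPos a (addNeg b L)} a≢t b≢t (∉⁅⁆⇒≢ b∉a)
      (∈-tested-addPos a (addNeg b L)) (tested-addPos a (addNeg b L) (∈-tested-addNeg b L)) setsL

  stump-src : ∀ {t a l r} → Valid t (node a l r) → SetsIn D F t (node a l r) →
              src (node a l r) ⊆ ⁅ a ⁆
  stump-src {a = a} {l = leaf}       {r = leaf}       _     _    =
    ⊆-reflexive (trans (cong (⁅ a ⁆ ∪_) (∪-identityʳ ∅)) (∪-identityʳ ⁅ a ⁆))
  stump-src         {l = node _ _ _}                  valid sets = ⊥-elim (no-nested-neg valid sets)
  stump-src         {l = leaf}       {r = node _ _ _} valid sets = ⊥-elim (no-nested-pos valid sets)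

  open SetPack D F

  initial-weight≤cost : ∀ {Ts} (b : Bests initState) → IsModel Ts → (∀ i → SetsIn D F i (Ts i)) →
                        weight b (λ i → root (Ts i)) ≤q totalExpCost D Ts
  initial-weight≤cost {Ts} b (valid , _) sets =
    prodQ-map-mono (edgeWeight-nonNeg b U) edgeWeight≤cost (allFin K)
    where
      open Bests b
      U = λ i → root (Ts i)

      edgeWeight≤cost : ∀ i → edgeWeight D (λ _ → ∅) (λ _ → false) B B' U i ≤q expCost D i (Ts i)
      edgeWeight≤cost i with Ts i | valid i | sets i
      ... | leaf       | validᵢ | setsᵢ = best-optimal (B-best i) leaf validᵢ ⊆-refl setsᵢ
      ... | node a l r | validᵢ | setsᵢ =
        best-optimal (B'-best i a refl) (node a l r) validᵢ
          (⊆-trans (stump-src validᵢ setsᵢ) (q⊆p∪q ∅ ⁅ a ⁆)) setsᵢ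

mainTheorem2 : ∀ {K : ℕ} (D : Dataset K) (F : Family K) →
    DownwardClosed F → (∀ X → F X → ∣ X ∣ ≤ 2) →
    ∀ (S : Fin K → Subset K) (r : Fin K → Bool) →
    Star (Step D F) initState (S , r) → (∀ i → r i ≡ true) →
    ∀ (Ts : Fin K → Tree K) → (∀ i → IsBest D F i (S i) (Ts i)) →
    IsModel Ts ×
    (∀ (Ts' : Fin K → Tree K) → IsModel Ts' → (∀ i → SetsIn D F i (Ts' i)) →
      totalExpCost D Ts ≤q totalExpCost D Ts')
mainTheorem2 D F _ small _ _ run finished Ts Ts-best = ((λ i → proj₁ (Ts-best i)) , acyclic) , optimal
  where
    open SetPack D F
    open Stumps small

    acyclic = finished-acyclic {Ts = Ts} (ranking-run run ranking-init) finished
                               (λ i → proj₁ (proj₂ (Ts-best i)))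

    final = finished-bests finished Ts-best
    initial = bests-run run final

    optimal : ∀ Ts' → IsModel Ts' → (∀ i → SetsIn D F i (Ts' i)) → totalExpCost D Ts ≤q totalExpCost D Ts'
    optimal Ts' model' sets' = ≤q-trans
      (lowerBound-run run final (lowerBound-finished finished Ts-best)
                      initial (λ i → root (Ts' i)) (λ _ _ _ → refl) (model-arborescence model'))
      (initial-weight≤cost initial model' sets')
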